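{- If the type configuration $G\parallel\mathcal M$ is weakly balanced and $G\parallel\mathcal M\xrightarrow{\beta}G'\parallel\mathcal M'$, then $G'\parallel\mathcal M'$ is weakly balanced.
   Context: Participants $\mathsf p,\mathsf q,\mathsf r,\mathsf s$; labels $\lambda$. A message is a triple $\langle\mathsf p,\lambda,\mathsf q\rangle$; a queue $\mathcal M$ is a finite sequence of messages ($\emptyset$ empty, $\cdot$ concatenation), taken modulo the congruence $\equiv$ generated by swapping adjacent messages $\langle\mathsf p,\lambda,\mathsf q\rangle\cdot\langle\mathsf r,\lambda',\mathsf s\rangle\equiv\langle\mathsf r,\lambda',\mathsf s\rangle\cdot\langle\mathsf p,\lambda,\mathsf q\rangle$ whenever $\mathsf p\neq\mathsf r$ or $\mathsf q\neq\mathsf s$. Communications are $\beta::=\mathsf p\mathsf q!\lambda\mid\mathsf p\mathsf q?\lambda$ with $\mathrm{play}(\mathsf p\mathsf q!\lambda)=\mathsf p$, $\mathrm{play}(\mathsf p\mathsf q?\lambda)=\mathsf q$. Global types are the possibly infinite regular terms coinductively generated by $G ::= \mathsf{End}\mid \mathsf p\mathsf q!\{\lambda_i;G_i\}_{i\in I}\mid\mathsf p\mathsf q?\{\lambda_i;G_i\}_{i\in I}$ ($I$ finite nonempty, $\mathsf p\neq\mathsf q$, $\lambda_i$ pairwise distinct). Type configuration transitions (inductive, queues modulo $\equiv$): (Top-Out) $\mathsf p\mathsf q!\{\lambda_i;G_i\}_{i\in I}\parallel\mathcal M\xrightarrow{\mathsf p\mathsf q!\lambda_h}G_h\parallel\mathcal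 M\cdot\langle\mathsf p,\lambda_h,\mathsf q\rangle$, $h\in I$; (Top-In) $\mathsf p\mathsf q?\{\lambda_i;G_i\}_{i\in I}\parallel\langle\mathsf p,\lambda_h,\mathsf q\rangle\cdot\mathcal M\xrightarrow{\mathsf p\mathsf q?\lambda_h}G_h\parallel\mathcal M$, $h\in I$; (Inside-Out) if $\mathsf p\neq\mathrm{play}(\beta)$ and $G_i\parallel\mathcal M\cdot\langle\mathsf p,\lambda_i,\mathsf q\rangle\xrightarrow{\beta}G'_i\parallel\mathcal M'\cdot\langle\mathsf p,\lambda_i,\mathsf q\rangle$ for all $i\in I$, then $\mathsf p\mathsf q!\{\lambda_i;G_i\}_{i\in I}\parallel\mathcal M\xrightarrow{\beta}\mathsf p\mathsf q!\{\lambda_i;G'_i\}_{i\in I}\parallel\mathcal M'$; (Inside-In) if $\mathsf q\neq\mathrm{play}(\beta)$, $h\in I$ and $G_i\parallel\mathcal M\xrightarrow{\beta}G'_i\parallel\mathcal M'$ for all $i\in I$, then $\mathsf p\mathsf q?\{\lambda_i;G_i\}_{i\in I}\parallel\langle\mathsf p,\lambda_h,\mathsf q\rangle\cdot\mathcal M\xrightarrow{\beta}\mathsf p\mathsf q?\{\lambda_i;G'_i\}_{i\in I}\parallel\langle\mathsf p,\lambda_h,\mathsf q\rangle\cdot\mathcal M'$. Weak balancing is defined coinductively (the largest predicate closed under): $\mathsf{End}\parallel\emptyset$ is weakly balanced; $\mathsf p\mathsf q!\{\lambda_i;G_i\}_{i\in I}\parallel\mathcal M$ is weakly balanced if $G_i\parallel\mathcal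 M\cdot\langle\mathsf p,\lambda_i,\mathsf q\rangle$ is weakly balanced for all $i\in I$; $\mathsf p\mathsf q?\{\lambda_i;G_i\}_{i\in I}\parallel\langle\mathsf p,\lambda_h,\mathsf q\rangle\cdot\mathcal M$ with $h\in I$ is weakly balanced if $G_h\parallel\mathcal M$ is weakly balanced. -}

module Defs where

open import Data.Nat using (ℕ; suc)
open import Data.Fin using (Fin)
open import Data.List using (List; []; _∷_; _++_; [_])
open import Data.Product using (Σ; ∃; ∃-syntax; _×_; _,_)
open import Data.Sum using (_⊎_)
open import Relation.Binary.PropositionalEquality using (_≡_; _≢_)

module _ {P L : Set} where

  record Msg : Set where
    constructor ⟨_,_,_⟩
    field
      sndr : P
      lbl  : L
      rcvr : P

  Queue : Set
  Queue = List Msg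

  -- the congruence ≡ on queues: reflexive-transitive closure (in context) of
  -- swapping adjacent messages with different sender or different receiver
  -- (the swap relation is symmetric, so this is an equivalence)
  data _≈Q_ : Queue → Queue → Set where
    ≈refl  : ∀ {M} → M ≈Q M
    ≈trans : ∀ {M₁ M₂ M₃} → M₁ ≈Q M₂ → M₂ ≈Q M₃ → M₁ ≈Q M₃
    ≈swap  : ∀ (M N : Queue) (p q r s : P) (l l′ : L) →
             (p ≢ r ⊎ q ≢ s) →
             (M ++ ⟨ p , l , q ⟩ ∷ ⟨ r , l′ , s ⟩ ∷ N) ≈Q
             (M ++ ⟨ r , l′ , s ⟩ ∷ ⟨ p , l , q ⟩ ∷ N)

  data Comm : Set where
    snd : P → P → L → Comm
    rcv : P → P → L → Comm

  play : Comm → P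
  play (snd p q l) = p
  play (rcv p q l) = q

  -- Two such
  -- representations denote the same term iff they are bisimilar (_≅_).
  Distinct : {n : ℕ} → (Fin (suc n) → L) → Set
  Distinct {n} lab = (i j : Fin (suc n)) → lab i ≡ lab j → i ≡ j

  data NodeF (S : Set) : Set where
    end : NodeF S
    out : (p q : P) → p ≢ q → (n : ℕ) → (lab : Fin (suc n) → L) →
          Distinct lab → (Fin (suc n) → S) → NodeF S
    inp : (p q : P) → p ≢ q → (n : ℕ) → (lab : Fin (suc n) → L) →
          Distinct lab → (Fin (suc n) → S) → NodeF S

  record GT : Set₁ where
    field
      State : Set
      δ     : State → NodeF State
      root  : State

  open GT public

  head : (G : GT) → NodeF (State G)
  head G = δ G (root G)

  at : (G : GT) → State G → GT
  at G s = record { State = State G ; δ = δ G ; root = s }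

  -- one step of bisimilarity: same node shape, same participants, and the
  -- same set of (label, continuation) branches (index sets may be ordered
  -- differently)
  data BisimF {S T : Set} (R : S → T → Set) : NodeF S → NodeF T → Set where
    b-end : BisimF R end end
    b-out : ∀ p q pq pq′ n n′ lab lab′ inj inj′ cs ds →
      (∀ i → ∃[ j ] (lab i ≡ lab′ j × R (cs i) (ds j))) →
      (∀ j → ∃[ i ] (lab i ≡ lab′ j × R (cs i) (ds j))) →
      BisimF R (out p q pq n lab inj cs) (out p q pq′ n′ lab′ inj′ ds)
    b-inp : ∀ p q pq pq′ n n′ lab lab′ inj inj′ cs ds →
      (∀ i → ∃[ j ] (lab i ≡ lab′ j × R (cs i) (ds j))) →
      (∀ j → ∃[ i ] (lab i ≡ lab′ j × R (cs i) (ds j))) →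
      BisimF R (inp p q pq n lab inj cs) (inp p q pq′ n′ lab′ inj′ ds)

  _≅_ : GT → GT → Set₁
  G ≅ H = ∃[ R ] (R (root G) (root H) ×
                  (∀ s t → R s t → BisimF {State G} {State H} R (δ G s) (δ H t)))

  data Step : GT → Queue → Comm → GT → Queue → Set₁ where
    top-out : ∀ {G M} p q pq n lab inj cs (h : Fin (suc n)) →
      head G ≡ out p q pq n lab inj cs →
      Step G M (snd p q (lab h)) (at G (cs h)) (M ++ [ ⟨ p , lab h , q ⟩ ])
    top-in : ∀ {G M} p q pq n lab inj cs (h : Fin (suc n)) →
      head G ≡ inp p q pq n lab inj cs →
      Step G (⟨ p , lab h , q ⟩ ∷ M) (rcv p q (lab h)) (at G (cs h)) M
    inside-out : ∀ {G G′ M M′ β} p q pq n lab inj cs cs′ →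
      head G ≡ out p q pq n lab inj cs →
      head G′ ≡ out p q pq n lab inj cs′ →
      p ≢ play β →
      (∀ i → Step (at G (cs i)) (M ++ [ ⟨ p , lab i , q ⟩ ]) β
                  (at G′ (cs′ i)) (M′ ++ [ ⟨ p , lab i , q ⟩ ])) →
      Step G M β G′ M′
    inside-in : ∀ {G G′ M M′ β} p q pq n lab inj cs cs′ (h : Fin (suc n)) →
      head G ≡ inp p q pq n lab inj cs →
      head G′ ≡ inp p q pq n lab inj cs′ →
      q ≢ play β →
      (∀ i → Step (at G (cs i)) M β (at G′ (cs′ i)) M′) →
      Step G (⟨ p , lab h , q ⟩ ∷ M) β G′ (⟨ p , lab h , q ⟩ ∷ M′)
    step-≈ : ∀ {G₁ G₂ G₃ G₄ M₁ M₂ M₃ M₄ β} →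
      G₁ ≅ G₂ → M₁ ≈Q M₂ → Step G₂ M₂ β G₃ M₃ → G₃ ≅ G₄ → M₃ ≈Q M₄ →
      Step G₁ M₁ β G₄ M₄

  data WBF (R : GT → Queue → Set) : GT → Queue → Set₁ where
    wb-end : ∀ {G M} → head G ≡ end → M ≈Q [] → WBF R G M
    wb-out : ∀ {G M} p q pq n lab inj cs →
      head G ≡ out p q pq n lab inj cs →
      (∀ i → R (at G (cs i)) (M ++ [ ⟨ p , lab i , q ⟩ ])) →
      WBF R G M
    wb-in : ∀ {G M} p q pq n lab inj cs (h : Fin (suc n)) M′ →
      head G ≡ inp p q pq n lab inj cs →
      M ≈Q (⟨ p , lab h , q ⟩ ∷ M′) →
      R (at G (cs h)) M′ →
      WBF R G M

  -- Weak balancing = the largest predicate closed under the rules, i.e.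
  -- membership in some post-fixed point R ⊆ WBF R (Knaster–Tarski).
  WeaklyBalanced : GT → Queue → Set₁
  WeaklyBalanced G M =
    ∃[ R ] (R G M × (∀ G₀ M₀ → R G₀ M₀ → WBF R G₀ M₀))

{-# OPTIONS --safe #-}
-- Weak balancing is a greatest fixed point, so it coincides with the
-- conjunction of its finite approximants (depth-k unfoldings of the rules);
-- these are small predicates, whereas the fixed point itself quantifies over
-- predicates on global types.  By induction on the transition, a
-- configuration satisfying the approximant of depth k + 1 steps to one
-- satisfying that of depth k.  Input steps rely on a cancellation property of
-- the queue congruence: two messages with the same sender and receiver never
-- swap, so equivalent queues starting with such messages carry the same head.
module Submission where

open import Defs
open import Data.Nat using (ℕ; zero; suc)
open import Data.Fin using (Fin)
open import Data.List using ([]; _∷_; _++_; [_])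
open import Data.List.Properties using (++-assoc; ∷-injectiveˡ; ∷-injectiveʳ)
open import Data.List.Relation.Unary.All using (All; []; _∷_)
open import Data.Product using (Σ; _×_; _,_)
open import Data.Sum using (_⊎_; inj₁; inj₂)
open import Data.Unit using (⊤; tt)
open import Data.Empty using (⊥-elim)
open import Relation.Binary.PropositionalEquality
  using (_≡_; _≢_; refl; sym; cong; subst; subst₂)

module _ {P L : Set} where

  Q : Set
  Q = Queue {P} {L}

  Swappable : Msg {P} {L} → Msg {P} {L} → Set
  Swappable x m = Msg.sndr x ≢ Msg.sndr m ⊎ Msg.rcvr x ≢ Msg.rcvr m

  ≈Q-swap : ∀ (M N : Q) a b → Swappable a b → (M ++ a ∷ b ∷ N) ≈Q (M ++ b ∷ a ∷ N)
  ≈Q-swap M N a b =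
    ≈swap M N (Msg.sndr a) (Msg.rcvr a) (Msg.sndr b) (Msg.rcvr b) (Msg.lbl a) (Msg.lbl b)

  ≈Q-sym : ∀ {A B : Q} → A ≈Q B → B ≈Q A
  ≈Q-sym ≈refl = ≈refl
  ≈Q-sym (≈trans r s) = ≈trans (≈Q-sym s) (≈Q-sym r)
  ≈Q-sym (≈swap M N p q r s l l′ (inj₁ ne)) =
    ≈swap M N r s p q l′ l (inj₁ (λ e → ne (sym e)))
  ≈Q-sym (≈swap M N p q r s l l′ (inj₂ ne)) =
    ≈swap M N r s p q l′ l (inj₂ (λ e → ne (sym e)))

  ≈Q-∷ : ∀ m {A B : Q} → A ≈Q B → (m ∷ A) ≈Q (m ∷ B)
  ≈Q-∷ m ≈refl = ≈refl
  ≈Q-∷ m (≈trans r s) = ≈trans (≈Q-∷ m r) (≈Q-∷ m s)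
  ≈Q-∷ m (≈swap M N p q r s l l′ c) = ≈swap (m ∷ M) N p q r s l l′ c

  ≈Q-++ʳ : ∀ (X : Q) {A B : Q} → A ≈Q B → (A ++ X) ≈Q (B ++ X)
  ≈Q-++ʳ X ≈refl = ≈refl
  ≈Q-++ʳ X (≈trans r s) = ≈trans (≈Q-++ʳ X r) (≈Q-++ʳ X s)
  ≈Q-++ʳ X (≈swap M N p q r s l l′ c) =
    subst₂ _≈Q_ (sym (++-assoc M _ X)) (sym (++-assoc M _ X))
      (≈swap M (N ++ X) p q r s l l′ c)

  -- The occurrence of x in C₁ ++ x ∷ C₂, preceded only by messages swappable
  -- with it, is tracked through the congruence into C.
  Exposed : Msg → Q → Q → Q → Set
  Exposed x C₁ C₂ C = Σ Q λ C₁′ → Σ Q λ C₂′ →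
    C ≡ C₁′ ++ x ∷ C₂′ × All (Swappable x) C₁′ × (C₁ ++ C₂) ≈Q (C₁′ ++ C₂′)

  exposed-swap : ∀ (M N : Q) a b → Swappable a b → ∀ C₁ x C₂ →
    M ++ a ∷ b ∷ N ≡ C₁ ++ x ∷ C₂ → All (Swappable x) C₁ →
    Exposed x C₁ C₂ (M ++ b ∷ a ∷ N)
  exposed-swap [] N a b ab [] x C₂ refl _ = b ∷ [] , N , refl , ab ∷ [] , ≈refl
  exposed-swap [] N a b ab (_ ∷ []) x C₂ refl _ = [] , a ∷ N , refl , [] , ≈refl
  exposed-swap [] N a b ab (_ ∷ _ ∷ C₁) x C₂ refl (xa ∷ xb ∷ xC₁) =
    b ∷ a ∷ C₁ , C₂ , refl , xb ∷ xa ∷ xC₁ , ≈Q-swap [] (C₁ ++ C₂) a b ab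
  exposed-swap (m ∷ M) N a b ab [] x C₂ refl _ =
    [] , M ++ b ∷ a ∷ N , refl , [] , ≈Q-swap M N a b ab
  exposed-swap (m ∷ M) N a b ab (c ∷ C₁) x C₂ eq (xc ∷ xC₁)
    with ∷-injectiveˡ eq | exposed-swap M N a b ab C₁ x C₂ (∷-injectiveʳ eq) xC₁
  ... | refl | C₁′ , C₂′ , e , xC₁′ , r =
    c ∷ C₁′ , C₂′ , cong (c ∷_) e , xc ∷ xC₁′ , ≈Q-∷ c r

  exposed-≈Q : ∀ {C C′ : Q} → C ≈Q C′ → ∀ C₁ x C₂ →
    C ≡ C₁ ++ x ∷ C₂ → All (Swappable x) C₁ → Exposed x C₁ C₂ C′
  exposed-≈Q ≈refl C₁ x C₂ e xC₁ = C₁ , C₂ , e , xC₁ , ≈refl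
  exposed-≈Q (≈trans r s) C₁ x C₂ e xC₁ with exposed-≈Q r C₁ x C₂ e xC₁
  ... | A₁ , A₂ , e′ , xA₁ , r′ with exposed-≈Q s A₁ x A₂ e′ xA₁
  ... | B₁ , B₂ , e″ , xB₁ , r″ = B₁ , B₂ , e″ , xB₁ , ≈trans r′ r″
  exposed-≈Q (≈swap M N p q r s l l′ c) = exposed-swap M N ⟨ p , l , q ⟩ ⟨ r , l′ , s ⟩ c

  ∷-cancel-≈Q : ∀ {x y : Msg} {A B : Q} → (x ∷ A) ≈Q (y ∷ B) →
    Msg.sndr x ≡ Msg.sndr y → Msg.rcvr x ≡ Msg.rcvr y → x ≡ y × A ≈Q B
  ∷-cancel-≈Q {x} {A = A} r es er with exposed-≈Q r [] x A refl []
  ... | [] , _ , refl , _ , r′ = refl , r′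
  ... | _ ∷ _ , _ , refl , inj₁ ne ∷ _ , _ = ⊥-elim (ne es)
  ... | _ ∷ _ , _ , refl , inj₂ ne ∷ _ , _ = ⊥-elim (ne er)

  Rules : {S : Set} → (S → Q → Set) → NodeF {P} {L} S → Q → Set
  Rules A end M = M ≈Q []
  Rules A (out p q _ n lab _ cs) M = ∀ i → A (cs i) (M ++ [ ⟨ p , lab i , q ⟩ ])
  Rules A (inp p q _ n lab _ cs) M =
    Σ (Fin (suc n)) λ h → Σ Q λ M′ → M ≈Q (⟨ p , lab h , q ⟩ ∷ M′) × A (cs h) M′

  Approx : {S : Set} → (S → NodeF {P} {L} S) → ℕ → S → Q → Set
  Approx δ zero s M = ⊤
  Approx δ (suc k) s M = Rules (Approx δ k) (δ s) M

  at-head : ∀ {S : Set} (A : S → Q → Set) {nd nd′ : NodeF S} {M} →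
    nd ≡ nd′ → Rules A nd M → Rules A nd′ M
  at-head A {M = M} = subst (λ nd → Rules A nd M)

  Rules-≈Q : {S : Set} (A : S → Q → Set) → (∀ s {M M′} → M ≈Q M′ → A s M → A s M′) →
    ∀ nd {M M′} → M ≈Q M′ → Rules A nd M → Rules A nd M′
  Rules-≈Q A A-≈Q end e w = ≈trans (≈Q-sym e) w
  Rules-≈Q A A-≈Q (out p q _ n lab _ cs) e w i = A-≈Q (cs i) (≈Q-++ʳ _ e) (w i)
  Rules-≈Q A A-≈Q (inp p q _ n lab _ cs) e (h , M′ , e′ , w) =
    h , M′ , ≈trans (≈Q-sym e) e′ , w

  Approx-≈Q : {S : Set} (δ : S → NodeF S) → ∀ k s {M M′} →
    M ≈Q M′ → Approx δ k s M → Approx δ k s M′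
  Approx-≈Q δ zero s e w = tt
  Approx-≈Q δ (suc k) s e w = Rules-≈Q (Approx δ k) (Approx-≈Q δ k) (δ s) e w

  -- Labels are distinct, so the head message determines the branch taken.
  Rules-inp⁻¹ : {S : Set} (A : S → Q → Set) →
    (∀ s {M M′} → M ≈Q M′ → A s M → A s M′) →
    ∀ p q pq n lab inj cs h {M} →
    Rules A (inp p q pq n lab inj cs) (⟨ p , lab h , q ⟩ ∷ M) → A (cs h) M
  Rules-inp⁻¹ A A-≈Q p q pq n lab inj cs h (h′ , M′ , e , w)
    with ∷-cancel-≈Q e refl refl
  ... | same , rest with inj h h′ (cong Msg.lbl same)
  ... | refl = A-≈Q (cs h) (≈Q-sym rest) w

  Rules-bisim : {S T : Set} (R : S → T → Set) (A : S → Q → Set) (B : T → Q → Set) →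
    (∀ s t M → R s t → A s M → B t M) →
    ∀ {nd nd′} → BisimF R nd nd′ → ∀ M → Rules A nd M → Rules B nd′ M
  Rules-bisim R A B A⇒B b-end M w = w
  Rules-bisim R A B A⇒B (b-out p q _ _ _ _ lab lab′ _ _ cs ds _ bw) M w j with bw j
  ... | i , le , r =
    subst (λ l → B (ds j) (M ++ [ ⟨ p , l , q ⟩ ])) le (A⇒B _ _ _ r (w i))
  Rules-bisim R A B A⇒B (b-inp p q _ _ _ _ lab lab′ _ _ cs ds fw _) M (h , M′ , e , w)
    with fw h
  ... | j , le , r =
    j , M′ , subst (λ l → M ≈Q (⟨ p , l , q ⟩ ∷ M′)) le e , A⇒B _ _ _ r w

  Approx-≅ : (G H : GT {P} {L}) → G ≅ H →
    ∀ k M → Approx (δ G) k (root G) M → Approx (δ H) k (root H) M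
  Approx-≅ G H (R , r₀ , bisim) k M = go k (root G) (root H) M r₀
    where
    go : ∀ k s t M → R s t → Approx (δ G) k s M → Approx (δ H) k t M
    go zero s t M r w = tt
    go (suc k) s t M r w =
      Rules-bisim R (Approx (δ G) k) (Approx (δ H) k) (go k) (bisim s t r) M w

  WeaklyBalanced⇒Approx : (G : GT {P} {L}) (M : Q) →
    WeaklyBalanced G M → ∀ k → Approx (δ G) k (root G) M
  WeaklyBalanced⇒Approx G M (R , r₀ , post) k = go k (root G) M r₀
    where
    go : ∀ k s N → R (at G s) N → Approx (δ G) k s N
    go zero s N r = tt
    go (suc k) s N r with post (at G s) N r
    ... | wb-end e c = at-head (Approx (δ G) k) (sym e) c
    ... | wb-out p q pq n lab inj cs e rs =
      at-head (Approx (δ G) k) (sym e) (λ i → go k (cs i) _ (rs i))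
    ... | wb-in p q pq n lab inj cs h M′ e c r′ =
      at-head (Approx (δ G) k) (sym e) (h , M′ , c , go k (cs h) M′ r′)

  AllApprox : GT {P} {L} → Q → Set
  AllApprox G M = ∀ k → Approx (δ G) k (root G) M

  AllApprox-post : (G : GT {P} {L}) (M : Q) → AllApprox G M → WBF AllApprox G M
  AllApprox-post G M all = go (head G) refl (λ k → all (suc k))
    where
    go : ∀ nd → head G ≡ nd → (∀ k → Rules (Approx (δ G) k) nd M) → WBF AllApprox G M
    go end e w = wb-end e (w 0)
    go (out p q pq n lab inj cs) e w = wb-out p q pq n lab inj cs e (λ i k → w k i)
    go (inp p q pq n lab inj cs) e w with w 0
    ... | h , M′ , e₀ , _ = wb-in p q pq n lab inj cs h M′ e e₀ λ k →
      Rules-inp⁻¹ (Approx (δ G) k) (Approx-≈Q (δ G) k) p q pq n lab inj cs h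
        (Rules-≈Q (Approx (δ G) k) (Approx-≈Q (δ G) k) (inp p q pq n lab inj cs) e₀ (w k))

  Approx⇒WeaklyBalanced : (G : GT {P} {L}) (M : Q) →
    AllApprox G M → WeaklyBalanced G M
  Approx⇒WeaklyBalanced G M all = AllApprox , all , AllApprox-post

  Step-Approx : ∀ {G G′ : GT {P} {L}} {M M′ β} → Step G M β G′ M′ →
    ∀ k → Approx (δ G) (suc k) (root G) M → Approx (δ G′) k (root G′) M′
  Step-Approx {G} (top-out p q pq n lab inj cs h e) k w = at-head (Approx (δ G) k) e w h
  Step-Approx {G} (top-in p q pq n lab inj cs h e) k w =
    Rules-inp⁻¹ (Approx (δ G) k) (Approx-≈Q (δ G) k) p q pq n lab inj cs h
      (at-head (Approx (δ G) k) e w)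
  Step-Approx (inside-out _ _ _ _ _ _ _ _ _ _ _ _) zero w = tt
  Step-Approx {G} {G′} (inside-out p q pq n lab inj cs cs′ e e′ _ st) (suc k) w =
    at-head (Approx (δ G′) k) (sym e′) λ i →
      Step-Approx (st i) k (at-head (Approx (δ G) (suc k)) e w i)
  Step-Approx (inside-in _ _ _ _ _ _ _ _ _ _ _ _ _) zero w = tt
  Step-Approx {G} {G′} {_ ∷ M} {_ ∷ M′}
    (inside-in p q pq n lab inj cs cs′ h e e′ _ st) (suc k) w =
    at-head (Approx (δ G′) k) (sym e′) (h , M′ , ≈refl , Step-Approx (st h) k
      (Rules-inp⁻¹ (Approx (δ G) (suc k)) (Approx-≈Q (δ G) (suc k))
        p q pq n lab inj cs h
        (at-head (Approx (δ G) (suc k)) e w)))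
  Step-Approx (step-≈ {G₁} {G₂} {G₃} {G₄} G₁≅G₂ M₁≈M₂ st G₃≅G₄ M₃≈M₄) k w =
    Approx-≅ G₃ G₄ G₃≅G₄ k _ (Approx-≈Q (δ G₃) k (root G₃) M₃≈M₄
      (Step-Approx st k (Approx-≈Q (δ G₂) (suc k) (root G₂) M₁≈M₂
        (Approx-≅ G₁ G₂ G₁≅G₂ (suc k) _ w))))

proposition4p6 : {P L : Set} (G G′ : GT {P} {L}) (M M′ : Queue) (β : Comm) →
    WeaklyBalanced G M → Step G M β G′ M′ → WeaklyBalanced G′ M′
proposition4p6 G G′ M M′ β wb st =
  Approx⇒WeaklyBalanced G′ M′ λ k → Step-Approx st k (WeaklyBalanced⇒Approx G M wb (suc k))
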